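{- Let $m\ge 0$ be an integer and $k=4m+3$. Let $n\ge 0$, and let $x_i,y_i,z_i\in\{0,1\}$ for $i=0,\dots,n$. For $t=0,1,\dots,n$ define $S_t=\sum_{i=n-t}^{n}(x_i+z_i-ky_i)2^i$. Let $t\in\{0,\dots,n\}$ and suppose $S_t\ge k2^{n-t}$. Then $S_j\ge k2^{n-j}$ for every integer $j$ with $t<j\le n$. -}

module Defs where

open import Data.Nat using (ℕ; zero; suc; _∸_; _^_)
open import Data.Integer using (ℤ; +_; _+_; _-_; _*_)

sumFrom : (f : ℕ → ℤ) → (a len : ℕ) → ℤ
sumFrom f a zero = + 0
sumFrom f a (suc len) = f a + sumFrom f (suc a) len

term : (k : ℕ) → (x y z : ℕ → ℕ) → ℕ → ℤ
term k x y z i = ((+ x i + + z i) - + k * + y i) * + (2 ^ i)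

S : (k n : ℕ) → (x y z : ℕ → ℕ) → ℕ → ℤ
S k n x y z t = sumFrom (term k x y z) (n ∸ t) (suc t)

{-# OPTIONS --safe #-}
module Submission where

-- Passing from S_t to S_{t+1} adds the single term at index a = n - t - 1, which is at least
-- -k 2^a because x_a, z_a ≥ 0 and y_a ≤ 1. So S_t ≥ k 2^(a+1) = 2 k 2^a leaves S_{t+1} ≥ k 2^a,
-- and the bound propagates up to j = n.

open import Defs
open import Data.Nat using (ℕ; _≤_; _<_; _*_; _+_; _∸_; _^_; suc; _≤′_; ≤′-refl; ≤′-step)
open import Data.Integer using (+_) renaming (_≤_ to _≤ℤ_)
import Data.Integer as ℤ
import Data.Integer.Properties as ℤ
import Data.Nat.Properties as ℕ
open import Algebra.Properties.CommutativeSemigroup ℕ.*-commutativeSemigroup using (x∙yz≈y∙xz)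
open import Data.Integer.Tactic.RingSolver using (solve-∀)
open import Relation.Binary.PropositionalEquality using (_≡_; sym; cong; subst)

induction-between : ∀ {ℓ} {P : ℕ → Set ℓ} {t n} → P t
                  → (∀ {s} → t ≤ s → s < n → P s → P (suc s))
                  → ∀ {j} → t ≤ j → j ≤ n → P j
induction-between {P = P} {t} {n} Pt step t≤j j≤n = go (ℕ.≤⇒≤′ t≤j) j≤n
  where
    go : ∀ {j} → t ≤′ j → j ≤ n → P j
    go ≤′-refl        _   = Pt
    go (≤′-step t≤′j) j<n = step (ℕ.≤′⇒≤ t≤′j) j<n (go t≤′j (ℕ.<⇒≤ j<n))

S-suc : ∀ k n x y z {t} → t < n
      → S k n x y z (suc t) ≡ term k x y z (n ∸ suc t) ℤ.+ S k n x y z t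
S-suc k n x y z {t} t<n =  -- n ∸ t is definitionally (1 + n) ∸ suc t
  cong (λ a → term k x y z (n ∸ suc t) ℤ.+ sumFrom (term k x y z) a (suc t))
       (sym (ℕ.+-∸-assoc 1 t<n))

digit-lower-bound : ∀ k a b p → b ≤ 1
                  → ℤ.- + (k * p) ≤ℤ (+ a ℤ.- + k ℤ.* + b) ℤ.* + p
digit-lower-bound k a b p b≤1 = begin
  ℤ.- + (k * p)                  ≡⟨ cong ℤ.-_ (ℤ.pos-* k p) ⟩
  ℤ.- (+ k ℤ.* + p)              ≡⟨ ℤ.neg-distribˡ-* (+ k) (+ p) ⟩
  ℤ.- + k ℤ.* + p                ≤⟨ ℤ.*-monoʳ-≤-nonNeg (+ p) coefficient-bound ⟩
  (+ a ℤ.- + k ℤ.* + b) ℤ.* + p  ∎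
  where
    open ℤ.≤-Reasoning
    kb≤k : k * b ≤ k
    kb≤k = ℕ.≤-trans (ℕ.*-monoʳ-≤ k b≤1) (ℕ.≤-reflexive (ℕ.*-identityʳ k))
    coefficient-bound : ℤ.- + k ≤ℤ + a ℤ.- + k ℤ.* + b
    coefficient-bound = begin
      ℤ.- + k                  ≤⟨ ℤ.neg-mono-≤ (ℤ.+≤+ kb≤k) ⟩
      ℤ.- + (k * b)            ≡⟨ cong ℤ.-_ (ℤ.pos-* k b) ⟩
      ℤ.- (+ k ℤ.* + b)        ≤⟨ ℤ.i≤j+i _ (+ a) ⟩
      + a ℤ.- + k ℤ.* + b      ∎

halving-bound : ∀ c {u v} → ℤ.- + c ≤ℤ u → + (2 * c) ≤ℤ v → + c ≤ℤ u ℤ.+ v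
halving-bound c {u} {v} -c≤u 2c≤v = begin
  + c                        ≡⟨ cancel (+ c) ⟩
  ℤ.- + c ℤ.+ + 2 ℤ.* + c    ≡⟨ cong (ℤ._+_ (ℤ.- + c)) (sym (ℤ.pos-* 2 c)) ⟩
  ℤ.- + c ℤ.+ + (2 * c)      ≤⟨ ℤ.+-mono-≤ -c≤u 2c≤v ⟩
  u ℤ.+ v                    ∎
  where
    open ℤ.≤-Reasoning
    cancel : ∀ C → C ≡ ℤ.- C ℤ.+ + 2 ℤ.* C
    cancel = solve-∀

S-bound-suc : ∀ k n x y z {t} → t < n → y (n ∸ suc t) ≤ 1
            → + (k * 2 ^ (n ∸ t)) ≤ℤ S k n x y z t
            → + (k * 2 ^ (n ∸ suc t)) ≤ℤ S k n x y z (suc t)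
S-bound-suc k n x y z {t} t<n ya≤1 St-bound =
  subst (+ (k * 2 ^ a) ≤ℤ_) (sym (S-suc k n x y z t<n))
    (halving-bound (k * 2 ^ a)
      (digit-lower-bound k (x a + z a) (y a) (2 ^ a) ya≤1)
      (subst (_≤ℤ S k n x y z t) (cong +_ doubled) St-bound))
  where
    a = n ∸ suc t
    doubled : k * 2 ^ (n ∸ t) ≡ 2 * (k * 2 ^ a)
    doubled = subst (λ e → k * 2 ^ e ≡ 2 * (k * 2 ^ a))
                    (sym (ℕ.+-∸-assoc 1 t<n)) (x∙yz≈y∙xz k 2 (2 ^ a))

lemma2p6 : (m n : ℕ) → (x y z : ℕ → ℕ)
    → (∀ i → i ≤ n → x i ≤ 1) → (∀ i → i ≤ n → y i ≤ 1) → (∀ i → i ≤ n → z i ≤ 1)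
    → (t : ℕ) → t ≤ n
    → + ((4 * m + 3) * 2 ^ (n ∸ t)) ≤ℤ S (4 * m + 3) n x y z t
    → ∀ j → t < j → j ≤ n
    → + ((4 * m + 3) * 2 ^ (n ∸ j)) ≤ℤ S (4 * m + 3) n x y z j
lemma2p6 m n x y z _ y≤1 _ t _ St-bound j t<j j≤n =
  induction-between {P = λ s → + (k * 2 ^ (n ∸ s)) ≤ℤ S k n x y z s}
    St-bound
    (λ {s} _ s<n → S-bound-suc k n x y z s<n (y≤1 (n ∸ suc s) (ℕ.m∸n≤m n (suc s))))
    (ℕ.<⇒≤ t<j) j≤n
  where
    k = 4 * m + 3
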